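{- Let $m,n\ge0$, $I\subseteq[m-1]$, $J\subseteq[n-1]$. Then \[ \mathbf m\big(\kappa_I(\nu),\kappa_J(\nu)\big)=\sum_{K\subseteq[m+n-1]}d_K\,\kappa_K(\nu),\qquad d_K=\sum_{\substack{A\in\binom{[m+n]}{n}:\ (I\#_AJ)\cap c(A)=\emptyset,\\ I\#_AJ\subseteq K\subseteq(I\#_AJ)\cup c(A)}}\Big(\frac{1}{1-\nu}\Big)^{|K\cap c_2(A)|}. \]
   Context: Notation: $[a,b]=\{t\in\mathbb Z:a\le t\le b\}$ (empty if $a>b$), $[n]=[1,n]$; $\binom{[N]}{n}$ is the set of $n$-element subsets of $[N]$. Fix an integer $\nu>1$; $C_\nu$ additive cyclic group of order $\nu$ (identity $0$), $\mathbbm1$ its trivial character, $\mathbbm{reg}$ its regular character. For a finite set $S$ of integers, $Q_S(\nu)=\bigoplus_{s\in S}C_\nu$ (identity $\bm0$); for $T\subseteq S$, $Q_T(\nu)$ is the subgroup of tuples vanishing outside $T$. $\mathrm{cf}(G)$: complex-valued functions on $G$. For $I\subseteq S$: $X_I$ is the set of irreducible characters $\psi$ of $Q_S(\nu)$ with $Q_I(\nu)\subseteq\ker\psi$ but $Q_{I\cup\{j\}}(\nu)\not\subseteq\ker\psi$ for all $j\in S\setminus I$; $\chi^I(\nu)=\sum_{\psi\in X_I}\psi(\bm0)\psi$; $\dot\chi^I(\nu)=\chi^I(\nu)/\chi^I(\nu)(\bm0)$; $\kappa_I(\nu)$ is the indicator function of the superclass $\{\bm g\in Q_S(\nu):g_s\neq0\iff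 s\in I\}$ (superclass identifier of the normal supercharacter theory of $Q_S(\nu)$ given by $\{Q_I(\nu):I\subseteq S\}$). $Q_n(\nu)=Q_{[n-1]}(\nu)$. Standardization $\iota_S:Q_S(\nu)\to Q_{t+1}(\nu)$, $(g_s)\mapsto(g_{s_i})_i$ for $S=\{s_1<\dots<s_t\}$, $\iota_S^*\phi=\phi\circ\iota_S$, and $S_I=\{s_i:i\in I\}$ for $I\subseteq[t]$. For disjoint $S,T$: $Q_S\times Q_T=Q_{S\cup T}$, $(\phi\otimes_S\psi)(a,b)=\phi(a)\psi(b)$; $\phi\otimes_1\psi$ for $\phi\in\mathrm{cf}(Q_N(\nu))$, $\psi\in\mathrm{cf}(C_\nu)$ places $\psi$ in new coordinate $N$. For $A\subseteq[N]$: $\mathrm{conn}(A)$ = maximal subsets of consecutive integers of $A$; $c_1(A)=\{\max B:B\in\mathrm{conn}(A)\}\setminus\{N\}$, $c_2(A)=\{\max B:B\in\mathrm{conn}([N]\setminus A)\}\setminus\{N\}$, $c(A)=c_1(A)\cup c_2(A)$. For $A\in\binom{[m+n]}{n}$, $A^c=[m+n]\setminus A$, $I\subseteq[m-1]$, $J\subseteq[n-1]$: $I\#_AJ=(A^c)_I\cup A_J\subseteq[m+n-1]$. Product: $\mathbf s_A(\phi,\psi)=\iota_{A^c}^*(\phi\otimes_1\frac{\mathbbm{reg}-\mathbbm1}{\nu-1})\otimes_{A^c}\iota_A^*(\psi\otimes_1\frac{\mathbbm{reg}-\mathbbm1}{\nu-1})$ for $\phi\in\mathrm{cf}(Q_m(\nu)),\psi\in\mathrm{cf}(Q_n(\nu))$;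 $\mathbf m_A(\phi,\psi)=\phi\psi$ if $m=0$ or $n=0$ (scalars), otherwise $\dot\chi^{c_1(A)}(\nu)\otimes_{c(A)}(\mathbf s_A(\phi,\psi)\downarrow_{Q_{[m+n-1]\setminus c(A)}(\nu)})$ with $\dot\chi^{c_1(A)}(\nu)$ taken for index set $c(A)$; $\mathbf m=\sum_{A\in\binom{[m+n]}{n}}\mathbf m_A$. -}

module Defs where

open import Data.Bool using (Bool; true; false; if_then_else_; not; _∧_)
open import Data.Nat as ℕ using (ℕ; zero; suc; _∸_; NonZero)
import Data.Nat.Properties as ℕP
open import Data.Fin using (Fin; toℕ)
import Data.Fin as F
open import Data.Integer using (+_)
open import Data.Rational using (ℚ; 0ℚ; 1ℚ; _+_; _*_; _-_; _/_; 1/_; ≢-nonZero)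
open import Data.Rational.Properties using (_≟_)
open import Data.Product using (_,_; proj₁; proj₂)
open import Data.List as L using (List; []; _∷_; _++_; length; filter)
open import Data.Vec as V using (Vec; []; _∷_; _∷ʳ_; init; last; replicate; zipWith)
open import Data.Vec.Properties using (≡-dec)
import Data.Bool.Properties as BP
open import Data.Fin.Subset using (Subset; ∣_∣; ∁; _∩_; _∪_; _⊆_; ⊥)
open import Data.Fin.Subset.Properties using (_⊆?_)
open import Relation.Nullary using (yes; no; does)
open import Relation.Binary.PropositionalEquality using (_≡_; subst)

-- Conventions.
-- * The integer interval [k] = {1,…,k} is represented by Fin k
--   (the Fin-element i stands for the integer toℕ i + 1); a subset of
--   [k] is a 'Subset k' (= Vec Bool k, true = inside).
-- * C_ν is Fin ν (addition mod ν), identity = the element with toℕ 0.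
-- * Q_{[k]}(ν) = ⊕_{s∈[k]} C_ν is Vec (Fin ν) k; for T ⊆ [k] the
--   subgroup Q_T(ν) is the set of vectors vanishing outside T.
--   Q_n(ν) = Q_{[n-1]}(ν) is Vec (Fin ν) (n ∸ 1).
-- * Class functions cf(Q_{[k]}(ν)) take values in ℚ (all functions in
--   the statement are ℚ-valued).

sumℚ : List ℚ → ℚ
sumℚ = L.foldr _+_ 0ℚ

prodℚ : List ℚ → ℚ
prodℚ = L.foldr _*_ 1ℚ

powℚ : ℚ → ℕ → ℚ
powℚ q zero    = 1ℚ
powℚ q (suc e) = q * powℚ q e

-- total reciprocal (only ever applied to nonzero arguments here)
recip : ℚ → ℚ
recip p with p ≟ 0ℚ
... | yes _   = 0ℚ
... | no p≢0 = 1/_ p {{≢-nonZero p≢0}}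

ℕ→ℚ : ℕ → ℚ
ℕ→ℚ k = + k / 1

allSubsets : (k : ℕ) → List (Subset k)
allSubsets zero    = [] ∷ []
allSubsets (suc k) = L.map (false ∷_) (allSubsets k) ++ L.map (true ∷_) (allSubsets k)

choose : (N n : ℕ) → List (Subset N)
choose N n = filter (λ A → ∣ A ∣ ℕ.≟ n) (allSubsets N)

module _ (ν : ℕ) {{nz : NonZero ν}} where

  zeroC : Fin ν
  zeroC = F.fromℕ< (ℕ.>-nonZero⁻¹ ν)

  isZero : Fin ν → Bool
  isZero g = toℕ g ℕ.≡ᵇ 0

  triv : Fin ν → ℚ
  triv _ = 1ℚ

  reg : Fin ν → ℚ
  reg g = if isZero g then ℕ→ℚ ν else 0ℚ

  ρ : Fin ν → ℚ
  ρ g = (reg g - triv g) * recip (ℕ→ℚ ν - 1ℚ)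

  CF : ℕ → Set
  CF k = Vec (Fin ν) k → ℚ

  support : ∀ {k} → Vec (Fin ν) k → Subset k
  support = V.map (λ x → not (isZero x))

  κ : ∀ {k} → Subset k → CF k
  κ I g = if does (≡-dec BP._≟_ (support g) I) then 1ℚ else 0ℚ

  -- χ^I(ν) for the normal supercharacter theory of Q_S(ν), S ⊆ [k],
  -- I ⊆ S:  χ^I = (⊗_{s∈I} 𝟙) ⊗ (⊗_{s∈S∖I} (reg − 𝟙))
  -- (= Σ_{ψ∈X_I} ψ(0)ψ, since the nontrivial irreducible characters of
  -- C_ν sum to reg − 𝟙); evaluated on g ∈ Q_S(ν) ⊆ Q_{[k]}(ν).
  χ : ∀ {k} → (I S : Subset k) → CF k
  χ I S g = prodℚ (V.toList (zipWith (λ p x →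
                 if (proj₂ p ∧ not (proj₁ p)) then reg x - triv x else 1ℚ)
                 (zipWith _,_ I S) g))

  zeros : ∀ {k} → Vec (Fin ν) k
  zeros = replicate _ zeroC

  χ̇ : ∀ {k} → (I S : Subset k) → CF k
  χ̇ I S g = χ I S g * recip (χ I S zeros)

  proj : ∀ {k} → Subset k → Vec (Fin ν) k → Vec (Fin ν) k
  proj T g = zipWith (λ b x → if b then x else zeroC) T g

  ⊗₁ρ : ∀ {k} → CF k → CF (suc k)
  ⊗₁ρ φ v = φ (init v) * ρ (last v)

  stdz : ∀ {N} → Subset N → Vec (Fin ν) N → List (Fin ν)
  stdz []          []       = []
  stdz (false ∷ S) (x ∷ xs) = stdz S xs
  stdz (true  ∷ S) (x ∷ xs) = x ∷ stdz S xs

  -- ι_S^* φ (g) = φ (ι_S g)  for φ ∈ cf(Q_{t+1}(ν)) = CF t, t = |S|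
  -- (the length test always succeeds where ι* is used below)
  ι* : ∀ {N t} → Subset N → CF t → CF N
  ι* {t = t} S φ g with length (stdz S g) ℕ.≟ t
  ... | yes e = φ (subst (Vec (Fin ν)) e (V.fromList (stdz S g)))
  ... | no _  = 0ℚ

-- c₁(A) = {max B : B ∈ conn(A)} ∖ {N} ⊆ [N-1]:  i is the maximum of a
-- maximal run of consecutive elements of A iff i ∈ A and i+1 ∉ A.
c₁ : ∀ {N} → Subset N → Subset (N ∸ 1)
c₁ []            = []
c₁ (a ∷ [])      = []
c₁ (a ∷ b ∷ A)   = (a ∧ not b) ∷ c₁ (b ∷ A)

c₂ : ∀ {N} → Subset N → Subset (N ∸ 1)
c₂ A = c₁ (∁ A)

c : ∀ {N} → Subset N → Subset (N ∸ 1)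
c A = c₁ A ∪ c₂ A

-- S_J = {s_j : j ∈ J} for S = {s_1 < … < s_t}, J given by its
-- characteristic list (j-th entry for j = 1,2,…; missing entries ∉ J)
sub : ∀ {N} → Subset N → List Bool → Subset N
sub []          js       = []
sub (false ∷ S) js       = false ∷ sub S js
sub (true  ∷ S) []       = false ∷ sub S []
sub (true  ∷ S) (j ∷ js) = j ∷ sub S js

-- a subset of [N] contained in [N-1], viewed as a subset of [N-1]
dropLast : ∀ {A : Set} {N} → Vec A N → Vec A (N ∸ 1)
dropLast []           = []
dropLast (x ∷ [])     = []
dropLast (x ∷ y ∷ xs) = x ∷ dropLast (y ∷ xs)

#[_,_] : ∀ m n → Subset (m ∸ 1) → Subset (m ℕ.+ n) → Subset (n ∸ 1) → Subset (m ℕ.+ n ∸ 1)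
#[ m , n ] I A J = dropLast (sub (∁ A) (V.toList I) ∪ sub A (V.toList J))

d : (ν m n : ℕ) → Subset (m ∸ 1) → Subset (n ∸ 1) → Subset (m ℕ.+ n ∸ 1) → ℚ
d ν m n I J K = sumℚ (L.map term (choose (m ℕ.+ n) n))
  where
  term : Subset (m ℕ.+ n) → ℚ
  term A with #[ m , n ] I A J
  ... | X = if does (≡-dec BP._≟_ (X ∩ c A) ⊥) ∧ does (X ⊆? K) ∧ does (K ⊆? (X ∪ c A))
            then powℚ (recip (1ℚ - ℕ→ℚ ν)) ∣ K ∩ c₂ A ∣
            else 0ℚ

module _ (ν : ℕ) {{nz : NonZero ν}} where

  -- 𝐬_A(φ,ψ) for m = suc m', n = suc n'
  𝐬 : ∀ m' n' → Subset (suc m' ℕ.+ suc n') → CF ν m' → CF ν n' → CF ν (suc m' ℕ.+ suc n')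
  𝐬 m' n' A φ ψ h = ι* ν (∁ A) (⊗₁ρ ν φ) h * ι* ν A (⊗₁ρ ν ψ) h

  -- 𝐦_A(φ,ψ) = χ̇^{c₁(A)} ⊗_{c(A)} (𝐬_A(φ,ψ) ↓ Q_{[m+n-1]∖c(A)}),
  -- Q_{[m+n-1]∖c(A)} ⊆ Q_{[m+n]} via last coordinate 0
  𝐦[_] : ∀ {m' n'} → Subset (suc m' ℕ.+ suc n') → CF ν m' → CF ν n' → CF ν (suc m' ℕ.+ suc n' ∸ 1)
  𝐦[_] {m'} {n'} A φ ψ g =
    χ̇ ν (c₁ A) (c A) (proj ν (c A) g) * 𝐬 m' n' A φ ψ (proj ν (∁ (c A)) g ∷ʳ zeroC ν)

  𝐦 : ∀ m n → CF ν (m ∸ 1) → CF ν (n ∸ 1) → CF ν (m ℕ.+ n ∸ 1)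
  𝐦 zero    n       φ ψ g = φ [] * ψ g
  𝐦 (suc m) zero    φ ψ g = φ (subst (Vec (Fin ν)) (ℕP.+-identityʳ m) g) * ψ []
  𝐦 (suc m) (suc n) φ ψ g = sumℚ (L.map (λ A → 𝐦[ A ] φ ψ g) (choose (suc m ℕ.+ suc n) (suc n)))

{-# OPTIONS --safe #-}
module Submission where

-- Evaluate both sides at g and let T be the support of g.  On the right,
-- κ_K(g) selects K = T, and the side condition of d_T says exactly that
-- T ∖ c(A) = I #_A J, so the right-hand side is
--   Σ_A [T ∖ c(A) = I #_A J] (1/(1-ν))^|T ∩ c₂(A)|.
-- On the left, χ̇^{c₁(A)} on the c(A)-part of g is a product of one factor
-- (reg − 𝟙)/(ν − 1) for each coordinate in c₂(A) = c(A) ∖ c₁(A); that factor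
-- is 1 at 0 and 1/(1-ν) elsewhere, which gives the same power of 1/(1-ν).
-- The product 𝐬_A is evaluated at a vector h that vanishes on c(A) and in the
-- last coordinate.  The largest element of A (and of A^c) is either that last
-- coordinate or the end of a run, which lies in c(A); so both standardizations
-- of h end in 0, where (reg − 𝟙)/(ν − 1) is 1.  What remains is the indicator
-- that these standardizations have supports I0 and J0.  A subset is determined
-- by its two standardizations along A^c and A, so this says that the support of h
-- is (I #_A J)0, i.e. T ∖ c(A) = I #_A J.  When m = 0 or n = 0 the only A is
-- [n] or ∅, and then c(A) = ∅.

open import Defs
open import Algebra.Lattice.Properties.BooleanAlgebra using (¬-involutive)
open import Data.Bool using (Bool; true; false; not; _∧_; _∨_; if_then_else_)
import Data.Bool.Properties as Bool
open import Data.Fin using (Fin)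
open import Data.Fin.Subset using (Subset; ∣_∣; ∁; _∩_; _∪_; ⊥; ⊤)
open import Data.Fin.Subset.Properties
  using ( _⊆?_; ∣∁p∣≡n∸∣p∣; ∣p∣≡n⇒p≡⊤; ∣⊤∣≡n; ∣⊥∣≡0
        ; ∪-comm; ∪-identityˡ; ∪-identityʳ; ∩-zeroʳ; ∩-identityˡ; ∪-∩-booleanAlgebra)
open import Data.Integer using (+_)
import Data.Integer.Properties as ℤ
open import Data.List as L using (List; []; _∷_; _++_; length; map; filter)
import Data.List.Properties as L
import Data.List.Relation.Unary.All as All
open import Data.List.Relation.Unary.All.Properties using (all-filter)
open import Data.Nat as ℕ using (ℕ; zero; suc; _≤_; _<_; z≤n; _+_; _∸_; NonZero)
import Data.Nat.Properties as ℕP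
open import Data.Product as Product using (∃-syntax; _×_; _,_; proj₁; proj₂)
open import Data.Product.Function.NonDependent.Propositional using (_×-cong_)
open import Data.Rational as ℚ using (ℚ; 0ℚ; 1ℚ; _*_; _-_; 1/_)
import Data.Rational.Properties as ℚ
open import Data.Rational.Solver using (module +-*-Solver)
open import Data.Rational.Unnormalised using (mkℚᵘ; *≡*)
open import Data.Vec as V using (Vec; []; _∷_; _∷ʳ_; toList; init; last; initLast; replicate)
import Data.Vec.Properties as V
open import Function using (_∘_; _⇔_; mk⇔)
open import Function.Related.Propositional using (module EquationalReasoning)
open import Relation.Binary.Definitions using (DecidableEquality)
open import Relation.Binary.PropositionalEquality
open import Relation.Nullary using (Dec; yes; no; does; _×-dec_; contradiction)
open import Relation.Nullary.Decidable using (does-⇔)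
open import Relation.Unary using (Pred; Decidable)

open +-*-Solver

private variable
  E E′ P Q : Set
  k t N : ℕ
  p q : ℚ

infix 4 _≟ₛ_
_≟ₛ_ : DecidableEquality (Subset N)
_≟ₛ_ = V.≡-dec Bool._≟_

infix 4 _≟ₗ_
_≟ₗ_ : DecidableEquality (List Bool)
_≟ₗ_ = L.≡-dec Bool._≟_

toList-injective : {xs ys : Vec E N} → toList xs ≡ toList ys → xs ≡ ys
toList-injective {xs = xs} {ys} e = trans (sym (V.cast-is-id refl xs)) (V.toList-injective refl xs ys e)

toList-subst : ∀ {m n} (e : m ≡ n) (xs : Vec E m) → toList (subst (Vec E) e xs) ≡ toList xs
toList-subst refl xs = refl

length-toList-∷ʳ : ∀ {x} (xs : Vec E N) → length (toList xs L.∷ʳ x) ≡ suc N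
length-toList-∷ʳ xs = trans (L.length-++ (toList xs)) (trans (ℕP.+-comm _ 1) (cong suc (V.length-toList xs)))

∷ʳ-cong⇔ : ∀ {x} {xs ys : List E} → (xs ≡ ys) ⇔ (xs L.∷ʳ x ≡ ys L.∷ʳ x)
∷ʳ-cong⇔ {x = x} {xs} {ys} = mk⇔ (cong (L._∷ʳ x)) (L.∷ʳ-injectiveˡ xs ys)

∷ʳ≡⇔≡init : ∀ {x} (xs : Vec E N) (ys : Vec E (suc N)) → last ys ≡ x → (xs ∷ʳ x ≡ ys) ⇔ (xs ≡ init ys)
∷ʳ≡⇔≡init {x = x} xs ys last≡x = mk⇔
  (λ e → trans (sym (V.init-∷ʳ x xs)) (cong init e))
  (λ e → trans (cong₂ _∷ʳ_ e (sym last≡x)) (sym (proj₂ (proj₂ (initLast ys)))))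

dropLast≡init : (xs : Vec E (suc N)) → dropLast xs ≡ init xs
dropLast≡init (x ∷ [])     = refl
dropLast≡init (x ∷ y ∷ xs) = cong (x ∷_) (dropLast≡init (y ∷ xs))

∁-involutive : (S : Subset N) → ∁ (∁ S) ≡ S
∁-involutive = ¬-involutive (∪-∩-booleanAlgebra _)

∁⊥≡⊤ : ∀ N → ∁ (⊥ {N}) ≡ ⊤
∁⊥≡⊤ N = V.map-replicate not false N

∣p∣≡0⇒p≡⊥ : (p : Subset N) → ∣ p ∣ ≡ 0 → p ≡ ⊥
∣p∣≡0⇒p≡⊥ []          _ = refl
∣p∣≡0⇒p≡⊥ (false ∷ p) e = cong (false ∷_) (∣p∣≡0⇒p≡⊥ p e)

-- Standardization

restrict : Subset N → Vec E N → List E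
restrict []          []       = []
restrict (false ∷ S) (x ∷ xs) = restrict S xs
restrict (true  ∷ S) (x ∷ xs) = x ∷ restrict S xs

length-restrict : (S : Subset N) (xs : Vec E N) → length (restrict S xs) ≡ ∣ S ∣
length-restrict []          []       = refl
length-restrict (false ∷ S) (x ∷ xs) = length-restrict S xs
length-restrict (true  ∷ S) (x ∷ xs) = cong suc (length-restrict S xs)

restrict-map : (f : E → E′) (S : Subset N) (xs : Vec E N) →
               restrict S (V.map f xs) ≡ L.map f (restrict S xs)
restrict-map f []          []       = refl
restrict-map f (false ∷ S) (x ∷ xs) = restrict-map f S xs
restrict-map f (true  ∷ S) (x ∷ xs) = cong (f x ∷_) (restrict-map f S xs)

restrict-empty : (S : Subset N) (xs : Vec E N) → ∣ S ∣ ≡ 0 → restrict S xs ≡ []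
restrict-empty []          []       _ = refl
restrict-empty (false ∷ S) (x ∷ xs) e = restrict-empty S xs e

sub-restrict : (S Y : Subset N) → sub (∁ S) (restrict (∁ S) Y) ∪ sub S (restrict S Y) ≡ Y
sub-restrict []          []      = refl
sub-restrict (true  ∷ S) (y ∷ Y) = cong (y ∷_) (sub-restrict S Y)
sub-restrict (false ∷ S) (y ∷ Y) = cong₂ _∷_ (Bool.∨-identityʳ y) (sub-restrict S Y)

restrict-sub : (S : Subset N) (js ks : List Bool) → length js ≡ ∣ S ∣ →
               restrict S (sub S js ∪ sub (∁ S) ks) ≡ js
restrict-sub []          []       ks       _ = refl
restrict-sub (true  ∷ S) (j ∷ js) ks       e = cong₂ _∷_ (Bool.∨-identityʳ j) (restrict-sub S js ks (ℕP.suc-injective e))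
restrict-sub (false ∷ S) js       []       e = restrict-sub S js [] e
restrict-sub (false ∷ S) js       (k ∷ ks) e = restrict-sub S js ks e

restrict-split⇔ : (S Y : Subset N) (P Q : List Bool) → length P ≡ ∣ ∁ S ∣ → length Q ≡ ∣ S ∣ →
                  (restrict (∁ S) Y ≡ P × restrict S Y ≡ Q) ⇔ Y ≡ sub (∁ S) P ∪ sub S Q
restrict-split⇔ S Y P Q ∣P∣ ∣Q∣ = mk⇔ to from
  where
  to : restrict (∁ S) Y ≡ P × restrict S Y ≡ Q → Y ≡ sub (∁ S) P ∪ sub S Q
  to (refl , refl) = sym (sub-restrict S Y)
  from : Y ≡ sub (∁ S) P ∪ sub S Q → restrict (∁ S) Y ≡ P × restrict S Y ≡ Q
  from refl =
    subst (λ S′ → restrict (∁ S) (sub (∁ S) P ∪ sub S′ Q) ≡ P) (∁-involutive S) (restrict-sub (∁ S) P Q ∣P∣) ,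
    trans (cong (restrict S) (∪-comm (sub (∁ S) P) (sub S Q))) (restrict-sub S Q P ∣Q∣)

sub-∷ʳ-false : (S : Subset N) (js : List Bool) → sub S (js L.∷ʳ false) ≡ sub S js
sub-∷ʳ-false []          js       = refl
sub-∷ʳ-false (false ∷ S) js       = cong (false ∷_) (sub-∷ʳ-false S js)
sub-∷ʳ-false (true  ∷ S) []       = refl
sub-∷ʳ-false (true  ∷ S) (j ∷ js) = cong (j ∷_) (sub-∷ʳ-false S js)

sub-[] : (S : Subset N) → sub S [] ≡ ⊥
sub-[] []          = refl
sub-[] (false ∷ S) = cong (false ∷_) (sub-[] S)
sub-[] (true  ∷ S) = cong (false ∷_) (sub-[] S)

last-sub : (S : Subset (suc N)) (js : List Bool) → length js ≤ ℕ.pred ∣ S ∣ → last (sub S js) ≡ false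
last-sub (false ∷ [])    js       _  = refl
last-sub (true  ∷ [])    []       _  = refl
last-sub (false ∷ s ∷ S) js       le = last-sub (s ∷ S) js le
last-sub (true  ∷ s ∷ S) []       _  = last-sub (s ∷ S) [] z≤n
last-sub (true  ∷ s ∷ S) (j ∷ js) le = last-sub (s ∷ S) js (ℕP.pred-mono-≤ le)

last-∪ : (X Y : Subset (suc N)) → last (X ∪ Y) ≡ last X ∨ last Y
last-∪ (x ∷ [])     (y ∷ [])     = refl
last-∪ (x ∷ x′ ∷ X) (y ∷ y′ ∷ Y) = last-∪ (x′ ∷ X) (y′ ∷ Y)

standardizations⇔# : ∀ {m n} (A : Subset (suc N)) (I : Subset m) (J : Subset n) (W : Subset N)
  {Z₁ Z₂ : List Bool} → ∣ ∁ A ∣ ≡ suc m → ∣ A ∣ ≡ suc n →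
  restrict (∁ A) (W ∷ʳ false) ≡ Z₁ L.∷ʳ false → restrict A (W ∷ʳ false) ≡ Z₂ L.∷ʳ false →
  (Z₁ ≡ toList I × Z₂ ≡ toList J) ⇔ W ≡ dropLast (sub (∁ A) (toList I) ∪ sub A (toList J))
standardizations⇔# {N = N} A I J W {Z₁} {Z₂} ∣∁A∣ ∣A∣ ends₁ ends₂ = begin
  (Z₁ ≡ toList I × Z₂ ≡ toList J)
    ∼⟨ ∷ʳ-cong⇔ ×-cong ∷ʳ-cong⇔ ⟩
  (Z₁ L.∷ʳ false ≡ toList I L.∷ʳ false × Z₂ L.∷ʳ false ≡ toList J L.∷ʳ false)
    ≡⟨ cong₂ (λ P Q → P ≡ toList I L.∷ʳ false × Q ≡ toList J L.∷ʳ false) (sym ends₁) (sym ends₂) ⟩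
  (restrict (∁ A) Y ≡ toList I L.∷ʳ false × restrict A Y ≡ toList J L.∷ʳ false)
    ∼⟨ restrict-split⇔ A Y _ _ (trans (length-toList-∷ʳ I) (sym ∣∁A∣)) (trans (length-toList-∷ʳ J) (sym ∣A∣)) ⟩
  Y ≡ sub (∁ A) (toList I L.∷ʳ false) ∪ sub A (toList J L.∷ʳ false)
    ≡⟨ cong₂ (λ P Q → Y ≡ P ∪ Q) (sub-∷ʳ-false (∁ A) (toList I)) (sub-∷ʳ-false A (toList J)) ⟩
  Y ≡ X
    ∼⟨ ∷ʳ≡⇔≡init W X lastX ⟩
  W ≡ init X
    ≡⟨ cong (W ≡_) (sym (dropLast≡init X)) ⟩
  W ≡ dropLast X ∎
  where
  open EquationalReasoning
  Y X : Subset (suc N)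
  Y = W ∷ʳ false
  X = sub (∁ A) (toList I) ∪ sub A (toList J)
  lastX : last X ≡ false
  lastX = trans (last-∪ (sub (∁ A) (toList I)) (sub A (toList J)))
                (cong₂ _∨_ (last-sub (∁ A) (toList I) (ℕP.≤-reflexive (trans (V.length-toList I) (cong ℕ.pred (sym ∣∁A∣)))))
                           (last-sub A (toList J) (ℕP.≤-reflexive (trans (V.length-toList J) (cong ℕ.pred (sym ∣A∣))))))

toList-init-sub-⊤ : (js : List Bool) → length js ≡ k → toList (init (sub (⊤ {suc k}) js)) ≡ js
toList-init-sub-⊤ {zero}  []       _ = refl
toList-init-sub-⊤ {suc k} (j ∷ js) e = cong (j ∷_) (toList-init-sub-⊤ js (ℕP.suc-injective e))

toList-#-⊤ : ∀ n (J : Subset (n ∸ 1)) → toList (#[ 0 , n ] [] ⊤ J) ≡ toList J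
toList-#-⊤ zero    []  = refl
toList-#-⊤ (suc n) J = begin
  toList (dropLast (sub (∁ ⊤) [] ∪ sub ⊤ (toList J)))
    ≡⟨ cong (toList ∘ dropLast) (trans (cong (_∪ sub ⊤ (toList J)) (sub-[] (∁ ⊤))) (∪-identityˡ _)) ⟩
  toList (dropLast (sub ⊤ (toList J)))
    ≡⟨ cong toList (dropLast≡init (sub ⊤ (toList J))) ⟩
  toList (init (sub ⊤ (toList J)))
    ≡⟨ toList-init-sub-⊤ (toList J) (V.length-toList J) ⟩
  toList J ∎
  where open ≡-Reasoning

toList-#-⊥ : ∀ m (I : Subset m) → toList (#[ suc m , 0 ] I ⊥ []) ≡ toList I
toList-#-⊥ m I = begin
  toList (dropLast (sub (∁ ⊥) (toList I) ∪ sub ⊥ []))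
    ≡⟨ cong (toList ∘ dropLast) (trans (cong (sub (∁ ⊥) (toList I) ∪_) (sub-[] ⊥)) (∪-identityʳ _)) ⟩
  toList (dropLast (sub (∁ ⊥) (toList I)))
    ≡⟨ cong (λ S → toList (dropLast (sub S (toList I)))) (∁⊥≡⊤ (suc m + 0)) ⟩
  toList (dropLast (sub ⊤ (toList I)))
    ≡⟨ cong toList (dropLast≡init (sub ⊤ (toList I))) ⟩
  toList (init (sub ⊤ (toList I)))
    ≡⟨ toList-init-sub-⊤ (toList I) (trans (V.length-toList I) (sym (ℕP.+-identityʳ m))) ⟩
  toList I ∎
  where open ≡-Reasoning

-- Ends of runs: c₁, c₂ and c

c₁∩c₂≡⊥ : (A : Subset N) → c₁ A ∩ c₂ A ≡ ⊥
c₁∩c₂≡⊥ []          = refl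
c₁∩c₂≡⊥ (a ∷ [])    = refl
c₁∩c₂≡⊥ (a ∷ b ∷ A) = cong₂ _∷_ (runs a b) (c₁∩c₂≡⊥ (b ∷ A))
  where
  runs : ∀ a b → (a ∧ not b) ∧ (not a ∧ not (not b)) ≡ false
  runs true  true  = refl
  runs true  false = refl
  runs false true  = refl
  runs false false = refl

c₁-replicate : ∀ N b → c₁ (replicate N b) ≡ ⊥
c₁-replicate zero          b = refl
c₁-replicate (suc zero)    b = refl
c₁-replicate (suc (suc N)) b = cong₂ _∷_ (Bool.∧-inverseʳ b) (c₁-replicate (suc N) b)

c₂-replicate : ∀ N b → c₂ (replicate N b) ≡ ⊥
c₂-replicate N b = trans (cong c₁ (V.map-replicate not b N)) (c₁-replicate N (not b))

c-replicate : ∀ N b → c (replicate N b) ≡ ⊥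
c-replicate N b = trans (cong₂ _∪_ (c₁-replicate N b) (c₂-replicate N b)) (∪-identityˡ ⊥)

-- The largest element of A is either the last position or the end of a run of A,
-- i.e. an element of c₁ A.
restrict-∷ʳ-false : (A : Subset (suc N)) (W : Subset N) → W ∩ c₁ A ≡ ⊥ → ∣ A ∣ ≡ suc k →
                    ∃[ Z ] restrict A (W ∷ʳ false) ≡ Z L.∷ʳ false
restrict-∷ʳ-false (true  ∷ [])         []      _    _ = [] , refl
restrict-∷ʳ-false (false ∷ [])         []      _    ()
restrict-∷ʳ-false (false ∷ b ∷ A)      (w ∷ W) disj e = restrict-∷ʳ-false (b ∷ A) W (V.∷-injectiveʳ disj) e
restrict-∷ʳ-false (true  ∷ true ∷ A)   (w ∷ W) disj _ =
  Product.map (w ∷_) (cong (w ∷_)) (restrict-∷ʳ-false (true ∷ A) W (V.∷-injectiveʳ disj) refl)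
restrict-∷ʳ-false (true  ∷ false ∷ A)  (w ∷ W) disj _ with ∣ A ∣ in ∣A∣
... | suc _ = Product.map (w ∷_) (cong (w ∷_)) (restrict-∷ʳ-false (false ∷ A) W (V.∷-injectiveʳ disj) ∣A∣)
... | zero  = [] , cong₂ _∷_ w≡false (restrict-empty (false ∷ A) (W ∷ʳ false) ∣A∣)
  where
  w≡false : w ≡ false
  w≡false = trans (sym (Bool.∧-identityʳ w)) (V.∷-injectiveˡ disj)

∁∪∩∩≡⊥ : (P Q T : Subset N) → (∁ (P ∪ Q) ∩ T) ∩ P ≡ ⊥
∁∪∩∩≡⊥ []      []      []      = refl
∁∪∩∩≡⊥ (p ∷ P) (q ∷ Q) (t ∷ T) = cong₂ _∷_ (head p) (∁∪∩∩≡⊥ P Q T)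
  where
  head : ∀ p → (not (p ∨ q) ∧ t) ∧ p ≡ false
  head true  = refl
  head false = Bool.∧-zeroʳ _

∪∩∁∩≡∩ : (C₁ C₂ T : Subset N) → C₁ ∩ C₂ ≡ ⊥ →
         ((C₁ ∪ C₂) ∩ ∁ C₁) ∩ ((C₁ ∪ C₂) ∩ T) ≡ T ∩ C₂
∪∩∁∩≡∩ []        []        []      _    = refl
∪∩∁∩≡∩ (c₁ ∷ C₁) (c₂ ∷ C₂) (t ∷ T) disj =
  cong₂ _∷_ (head c₁ c₂ (V.∷-injectiveˡ disj)) (∪∩∁∩≡∩ C₁ C₂ T (V.∷-injectiveʳ disj))
  where
  head : ∀ c₁ c₂ → c₁ ∧ c₂ ≡ false → ((c₁ ∨ c₂) ∧ not c₁) ∧ ((c₁ ∨ c₂) ∧ t) ≡ t ∧ c₂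
  head true  false _ = sym (Bool.∧-zeroʳ t)
  head false true  _ = sym (Bool.∧-identityʳ t)
  head false false _ = sym (Bool.∧-zeroʳ t)

does-sandwich : (X C T : Subset N) →
  does (X ∩ C ≟ₛ ⊥) ∧ does (X ⊆? T) ∧ does (T ⊆? X ∪ C) ≡ does (∁ C ∩ T ≟ₛ X)
does-sandwich []          []          []          = refl
does-sandwich (false ∷ X) (false ∷ C) (false ∷ T) = does-sandwich X C T
does-sandwich (false ∷ X) (false ∷ C) (true  ∷ T) =
  trans (cong (does (X ∩ C ≟ₛ ⊥) ∧_) (Bool.∧-zeroʳ _)) (Bool.∧-zeroʳ _)
does-sandwich (false ∷ X) (true  ∷ C) (false ∷ T) = does-sandwich X C T
does-sandwich (false ∷ X) (true  ∷ C) (true  ∷ T) = does-sandwich X C T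
does-sandwich (true  ∷ X) (false ∷ C) (false ∷ T) = Bool.∧-zeroʳ _
does-sandwich (true  ∷ X) (false ∷ C) (true  ∷ T) = does-sandwich X C T
does-sandwich (true  ∷ X) (true  ∷ C) (false ∷ T) = refl
does-sandwich (true  ∷ X) (true  ∷ C) (true  ∷ T) = refl

indicator : Dec P → ℚ
indicator P? = if does P? then 1ℚ else 0ℚ

indicator-⇔ : P ⇔ Q → (P? : Dec P) (Q? : Dec Q) → indicator P? ≡ indicator Q?
indicator-⇔ P⇔Q P? Q? = cong (λ b → if b then 1ℚ else 0ℚ) (does-⇔ P⇔Q P? Q?)

indicator-×-dec : (P? : Dec P) (Q? : Dec Q) → indicator P? * indicator Q? ≡ indicator (P? ×-dec Q?)
indicator-×-dec (yes _) (yes _) = refl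
indicator-×-dec (yes _) (no  _) = refl
indicator-×-dec (no  _) (yes _) = refl
indicator-×-dec (no  _) (no  _) = refl

*-indicator : ∀ x (P? : Dec P) → x * indicator P? ≡ (if does P? then x else 0ℚ)
*-indicator x (yes _) = ℚ.*-identityʳ x
*-indicator x (no  _) = ℚ.*-zeroʳ x

recip-inverseʳ : p ≢ 0ℚ → p * recip p ≡ 1ℚ
recip-inverseʳ {p} p≢0 with p ℚ.≟ 0ℚ
... | yes p≡0 = contradiction p≡0 p≢0
... | no  p≢0 = ℚ.*-inverseʳ p {{ℚ.≢-nonZero p≢0}}

recip-unique : p * q ≡ 1ℚ → recip p ≡ q
recip-unique {p} {q} pq≡1 with p ℚ.≟ 0ℚ
... | yes refl = contradiction (trans (sym (ℚ.*-zeroˡ q)) pq≡1) λ ()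
... | no  p≢0  = begin
  1/ p              ≡⟨ sym (ℚ.*-identityʳ (1/ p)) ⟩
  1/ p * 1ℚ         ≡⟨ cong (1/ p *_) (sym pq≡1) ⟩
  1/ p * (p * q)    ≡⟨ sym (ℚ.*-assoc (1/ p) p q) ⟩
  (1/ p * p) * q    ≡⟨ cong (_* q) (ℚ.*-inverseˡ p) ⟩
  1ℚ * q            ≡⟨ ℚ.*-identityˡ q ⟩
  q                 ∎
  where
  open ≡-Reasoning
  instance _ = ℚ.≢-nonZero p≢0

recip-* : ∀ p q → recip (p * q) ≡ recip p * recip q
recip-* p q = by-cases (p ℚ.≟ 0ℚ) (q ℚ.≟ 0ℚ)
  where
  open ≡-Reasoning
  by-cases : Dec (p ≡ 0ℚ) → Dec (q ≡ 0ℚ) → recip (p * q) ≡ recip p * recip q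
  by-cases (yes refl) _ = trans (cong recip (ℚ.*-zeroˡ q)) (sym (ℚ.*-zeroˡ (recip q)))
  by-cases (no _) (yes refl) = trans (cong recip (ℚ.*-zeroʳ p)) (sym (ℚ.*-zeroʳ (recip p)))
  by-cases (no p≢0) (no q≢0) = recip-unique {p * q} (begin
    (p * q) * (recip p * recip q)
      ≡⟨ solve 4 (λ a b a′ b′ → (a :* b) :* (a′ :* b′) := (a :* a′) :* (b :* b′)) refl p q (recip p) (recip q) ⟩
    (p * recip p) * (q * recip q)
      ≡⟨ cong₂ _*_ (recip-inverseʳ p≢0) (recip-inverseʳ q≢0) ⟩
    1ℚ ∎)

sumℚ-++ : (xs ys : List ℚ) → sumℚ (xs ++ ys) ≡ sumℚ xs ℚ.+ sumℚ ys
sumℚ-++ []       ys = sym (ℚ.+-identityˡ _)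
sumℚ-++ (x ∷ xs) ys = trans (cong (x ℚ.+_) (sumℚ-++ xs ys)) (sym (ℚ.+-assoc x _ _))

sumℚ-0 : (xs : List E) → sumℚ (map (λ _ → 0ℚ) xs) ≡ 0ℚ
sumℚ-0 []       = refl
sumℚ-0 (x ∷ xs) = trans (ℚ.+-identityˡ _) (sumℚ-0 xs)

sumℚ-*ʳ : (f : E → ℚ) (xs : List E) (q : ℚ) → sumℚ (map f xs) * q ≡ sumℚ (map (λ x → f x * q) xs)
sumℚ-*ʳ f []       q = ℚ.*-zeroˡ q
sumℚ-*ʳ f (x ∷ xs) q = trans (ℚ.*-distribʳ-+ q (f x) _) (cong (f x * q ℚ.+_) (sumℚ-*ʳ f xs q))

sumℚ-+ : (f g : E → ℚ) (xs : List E) →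
         sumℚ (map f xs) ℚ.+ sumℚ (map g xs) ≡ sumℚ (map (λ x → f x ℚ.+ g x) xs)
sumℚ-+ f g []       = refl
sumℚ-+ f g (x ∷ xs) = trans
  (solve 4 (λ a s b t → (a :+ s) :+ (b :+ t) := (a :+ b) :+ (s :+ t)) refl (f x) (sumℚ (map f xs)) (g x) (sumℚ (map g xs)))
  (cong (f x ℚ.+ g x ℚ.+_) (sumℚ-+ f g xs))

sumℚ-swap : (t : E → E′ → ℚ) (xs : List E) (ys : List E′) →
  sumℚ (map (λ y → sumℚ (map (λ x → t x y) xs)) ys) ≡ sumℚ (map (λ x → sumℚ (map (t x) ys)) xs)
sumℚ-swap t xs []       = sym (sumℚ-0 xs)
sumℚ-swap t xs (y ∷ ys) = trans (cong (sumℚ (map (λ x → t x y) xs) ℚ.+_) (sumℚ-swap t xs ys))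
                                (sumℚ-+ (λ x → t x y) (λ x → sumℚ (map (t x) ys)) xs)

sumℚ-filter : ∀ {P : Pred E _} (P? : Decidable P) (f : E → ℚ) (xs : List E) →
  sumℚ (map f (filter P? xs)) ≡ sumℚ (map (λ x → f x * indicator (P? x)) xs)
sumℚ-filter P? f []       = refl
sumℚ-filter P? f (x ∷ xs) with P? x
... | yes _ = cong₂ ℚ._+_ (sym (ℚ.*-identityʳ (f x))) (sumℚ-filter P? f xs)
... | no  _ = trans (sumℚ-filter P? f xs) (sym (trans (cong (ℚ._+ _) (ℚ.*-zeroʳ (f x))) (ℚ.+-identityˡ _)))

sumℚ-allSubsets-indicator : (f : Subset k → ℚ) (K₀ : Subset k) →
  sumℚ (map (λ K → f K * indicator (K₀ ≟ₛ K)) (allSubsets k)) ≡ f K₀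
sumℚ-allSubsets-indicator f []       = trans (ℚ.+-identityʳ _) (ℚ.*-identityʳ (f []))
sumℚ-allSubsets-indicator f (b ∷ K₀) = begin
  sumℚ (map F (map (false ∷_) S ++ map (true ∷_) S))
    ≡⟨ cong sumℚ (L.map-++ F (map (false ∷_) S) (map (true ∷_) S)) ⟩
  sumℚ (map F (map (false ∷_) S) ++ map F (map (true ∷_) S))
    ≡⟨ sumℚ-++ (map F (map (false ∷_) S)) (map F (map (true ∷_) S)) ⟩
  sumℚ (map F (map (false ∷_) S)) ℚ.+ sumℚ (map F (map (true ∷_) S))
    ≡⟨ cong₂ ℚ._+_ (cong sumℚ (sym (L.map-∘ S))) (cong sumℚ (sym (L.map-∘ S))) ⟩
  sumℚ (map (F ∘ (false ∷_)) S) ℚ.+ sumℚ (map (F ∘ (true ∷_)) S)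
    ≡⟨ halves b ⟩
  f (b ∷ K₀) ∎
  where
  open ≡-Reasoning
  S : List (Subset _)
  S = allSubsets _
  F : Subset (suc _) → ℚ
  F K = f K * indicator (b ∷ K₀ ≟ₛ K)
  vanishing : ∀ b′ → sumℚ (map (λ K → f (b′ ∷ K) * 0ℚ) S) ≡ 0ℚ
  vanishing b′ = trans (cong sumℚ (L.map-cong (λ K → ℚ.*-zeroʳ (f (b′ ∷ K))) S)) (sumℚ-0 S)
  halves : ∀ b → sumℚ (map (λ K → f (false ∷ K) * indicator (b ∷ K₀ ≟ₛ false ∷ K)) S)
                 ℚ.+ sumℚ (map (λ K → f (true ∷ K) * indicator (b ∷ K₀ ≟ₛ true ∷ K)) S) ≡ f (b ∷ K₀)
  halves false = trans (cong₂ ℚ._+_ (sumℚ-allSubsets-indicator (f ∘ (false ∷_)) K₀) (vanishing true)) (ℚ.+-identityʳ _)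
  halves true  = trans (cong₂ ℚ._+_ (vanishing false) (sumℚ-allSubsets-indicator (f ∘ (true ∷_)) K₀)) (ℚ.+-identityˡ _)

sumℚ-choose-unique : ∀ N n (K₀ : Subset N) → (∀ (A : Subset N) → ∣ A ∣ ≡ n → K₀ ≡ A) → ∣ K₀ ∣ ≡ n →
  (f : Subset N → ℚ) → sumℚ (map f (choose N n)) ≡ f K₀
sumℚ-choose-unique N n K₀ unique ∣K₀∣ f = begin
  sumℚ (map f (choose N n))
    ≡⟨ sumℚ-filter (λ A → ∣ A ∣ ℕ.≟ n) f (allSubsets N) ⟩
  sumℚ (map (λ A → f A * indicator (∣ A ∣ ℕ.≟ n)) (allSubsets N))
    ≡⟨ cong sumℚ (L.map-cong (λ A → cong (f A *_)
         (indicator-⇔ (mk⇔ (unique A) (λ { refl → ∣K₀∣ })) (∣ A ∣ ℕ.≟ n) (K₀ ≟ₛ A))) (allSubsets N)) ⟩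
  sumℚ (map (λ A → f A * indicator (K₀ ≟ₛ A)) (allSubsets N))
    ≡⟨ sumℚ-allSubsets-indicator f K₀ ⟩
  f K₀ ∎
  where open ≡-Reasoning

-- The superclass computation

isZero-zeroC : ∀ ν {{_ : NonZero ν}} → isZero ν (zeroC ν) ≡ true
isZero-zeroC (suc _) = refl

ℕ→ℚ≢1 : ∀ {ν} → 1 < ν → ℕ→ℚ ν ≢ 1ℚ
ℕ→ℚ≢1 {ν} 1<ν ν≡1 with ℚ./-injective-≃ (mkℚᵘ (+ ν) 0) (mkℚᵘ (+ 1) 0) ν≡1
... | *≡* eq = ℕP.<⇒≢ 1<ν (sym (ℤ.+-injective (trans (sym (ℤ.*-identityʳ (+ ν))) eq)))

module _ (ν : ℕ) {{_ : NonZero ν}} where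

  1/[1-ν] : ℚ
  1/[1-ν] = recip (1ℚ - ℕ→ℚ ν)

  ρ-nonzero : ∀ x → isZero ν x ≡ false → ρ ν x ≡ 1/[1-ν]
  ρ-nonzero x x≢0 = begin
    ρ ν x
      ≡⟨ cong (λ b → ((if b then ℕ→ℚ ν else 0ℚ) - 1ℚ) * recip (ℕ→ℚ ν - 1ℚ)) x≢0 ⟩
    -- 0ℚ - 1ℚ is its own reciprocal, by evaluation.
    recip (0ℚ - 1ℚ) * recip (ℕ→ℚ ν - 1ℚ)
      ≡⟨ sym (recip-* (0ℚ - 1ℚ) (ℕ→ℚ ν - 1ℚ)) ⟩
    recip ((0ℚ - 1ℚ) * (ℕ→ℚ ν - 1ℚ))
      ≡⟨ cong recip (solve 1 (λ n → (con 0ℚ :- con 1ℚ) :* (n :- con 1ℚ) := con 1ℚ :- n) refl (ℕ→ℚ ν)) ⟩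
    1/[1-ν] ∎
    where open ≡-Reasoning

  χ̇-∷ : ∀ c s x (C S : Subset k) g →
        χ̇ ν (c ∷ C) (s ∷ S) (x ∷ g) ≡ χ̇ ν (c ∷ []) (s ∷ []) (x ∷ []) * χ̇ ν C S g
  χ̇-∷ c s x C S g = begin
    (f x * χ ν C S g) * recip (f z * χ ν C S (zeros ν))
      ≡⟨ cong ((f x * χ ν C S g) *_) (recip-* (f z) (χ ν C S (zeros ν))) ⟩
    (f x * χ ν C S g) * (recip (f z) * recip (χ ν C S (zeros ν)))
      ≡⟨ solve 4 (λ a b c d → (a :* b) :* (c :* d) := ((a :* con 1ℚ) :* c) :* (b :* d)) refl
               (f x) (χ ν C S g) (recip (f z)) (recip (χ ν C S (zeros ν))) ⟩
    ((f x * 1ℚ) * recip (f z)) * χ̇ ν C S g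
      ≡⟨ cong (λ w → ((f x * 1ℚ) * recip w) * χ̇ ν C S g) (sym (ℚ.*-identityʳ (f z))) ⟩
    ((f x * 1ℚ) * recip (f z * 1ℚ)) * χ̇ ν C S g ∎
    where
    open ≡-Reasoning
    z : Fin ν
    z = zeroC ν
    f : Fin ν → ℚ
    f y = if s ∧ not c then reg ν y - triv ν y else 1ℚ

  χ̇-singleton≡ρ : ∀ x → χ̇ ν (false ∷ []) (true ∷ []) (x ∷ []) ≡ ρ ν x
  χ̇-singleton≡ρ x = cong₂ (λ a b → a * recip b) (ℚ.*-identityʳ (reg ν x - 1ℚ))
    (trans (ℚ.*-identityʳ (reg ν (zeroC ν) - 1ℚ)) (cong (λ b → (if b then ℕ→ℚ ν else 0ℚ) - 1ℚ) (isZero-zeroC ν)))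

  stdz≡restrict : (S : Subset N) (g : Vec (Fin ν) N) → stdz ν S g ≡ restrict S g
  stdz≡restrict []          []      = refl
  stdz≡restrict (false ∷ S) (x ∷ g) = stdz≡restrict S g
  stdz≡restrict (true  ∷ S) (x ∷ g) = cong (x ∷_) (stdz≡restrict S g)

  support-proj : (T : Subset N) (g : Vec (Fin ν) N) → support ν (proj ν T g) ≡ T ∩ support ν g
  support-proj []          []      = refl
  support-proj (true  ∷ T) (x ∷ g) = cong (_ ∷_) (support-proj T g)
  support-proj (false ∷ T) (x ∷ g) = cong₂ _∷_ (cong not (isZero-zeroC ν)) (support-proj T g)

  -- Definitionally the summand of d ν m n I J K indexed by A.
  dTerm : (m n : ℕ) → Subset (m ∸ 1) → Subset (n ∸ 1) → Subset (m + n ∸ 1) → Subset (m + n) → ℚ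
  dTerm m n I J K A =
    if does (X ∩ c A ≟ₛ ⊥) ∧ does (X ⊆? K) ∧ does (K ⊆? X ∪ c A)
    then powℚ 1/[1-ν] ∣ K ∩ c₂ A ∣
    else 0ℚ
    where
    X : Subset (m + n ∸ 1)
    X = #[ m , n ] I A J

  dTerm≡ : ∀ m n I J K A →
    dTerm m n I J K A ≡ powℚ 1/[1-ν] ∣ K ∩ c₂ A ∣ * indicator (∁ (c A) ∩ K ≟ₛ #[ m , n ] I A J)
  dTerm≡ m n I J K A =
    trans (cong (λ b → if b then powℚ 1/[1-ν] ∣ K ∩ c₂ A ∣ else 0ℚ) (does-sandwich (#[ m , n ] I A J) (c A) K))
          (sym (*-indicator _ (∁ (c A) ∩ K ≟ₛ #[ m , n ] I A J)))

  dTerm-replicate : ∀ m n I J K b →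
    dTerm m n I J K (replicate (m + n) b) ≡ indicator (K ≟ₛ #[ m , n ] I (replicate (m + n) b) J)
  dTerm-replicate m n I J K b = begin
    dTerm m n I J K R
      ≡⟨ dTerm≡ m n I J K R ⟩
    powℚ 1/[1-ν] ∣ K ∩ c₂ R ∣ * indicator (∁ (c R) ∩ K ≟ₛ X)
      ≡⟨ cong₂ (λ C₂ C → powℚ 1/[1-ν] ∣ K ∩ C₂ ∣ * indicator (∁ C ∩ K ≟ₛ X))
               (c₂-replicate (m + n) b) (c-replicate (m + n) b) ⟩
    powℚ 1/[1-ν] ∣ K ∩ ⊥ ∣ * indicator (∁ ⊥ ∩ K ≟ₛ X)
      ≡⟨ cong₂ (λ j U → powℚ 1/[1-ν] j * indicator (U ≟ₛ X))
               (trans (cong ∣_∣ (∩-zeroʳ K)) (∣⊥∣≡0 (m + n ∸ 1)))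
               (trans (cong (_∩ K) (∁⊥≡⊤ (m + n ∸ 1))) (∩-identityˡ K)) ⟩
    1ℚ * indicator (K ≟ₛ X)
      ≡⟨ ℚ.*-identityˡ _ ⟩
    indicator (K ≟ₛ X) ∎
    where
    open ≡-Reasoning
    R : Subset (m + n)
    R = replicate (m + n) b
    X : Subset (m + n ∸ 1)
    X = #[ m , n ] I R J

  sumℚ-d-κ : ∀ m n I J (g : Vec (Fin ν) (m + n ∸ 1)) →
    sumℚ (map (λ K → d ν m n I J K * κ ν K g) (allSubsets (m + n ∸ 1)))
      ≡ sumℚ (map (dTerm m n I J (support ν g)) (choose (m + n) n))
  sumℚ-d-κ m n I J g = begin
    sumℚ (map (λ K → sumℚ (map (dTerm m n I J K) As) * κ ν K g) Ks)
      ≡⟨ cong sumℚ (L.map-cong (λ K → sumℚ-*ʳ (dTerm m n I J K) As (κ ν K g)) Ks) ⟩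
    sumℚ (map (λ K → sumℚ (map (λ A → dTerm m n I J K A * κ ν K g) As)) Ks)
      ≡⟨ sumℚ-swap (λ A K → dTerm m n I J K A * κ ν K g) As Ks ⟩
    sumℚ (map (λ A → sumℚ (map (λ K → dTerm m n I J K A * κ ν K g) Ks)) As)
      ≡⟨ cong sumℚ (L.map-cong (λ A → sumℚ-allSubsets-indicator (λ K → dTerm m n I J K A) (support ν g)) As) ⟩
    sumℚ (map (dTerm m n I J (support ν g)) As) ∎
    where
    open ≡-Reasoning
    Ks : List (Subset (m + n ∸ 1))
    Ks = allSubsets (m + n ∸ 1)
    As : List (Subset (m + n))
    As = choose (m + n) n

  κ-subst : ∀ {k k′} (e : k ≡ k′) (X : Subset k) (I : Subset k′) (g : Vec (Fin ν) k) →
            toList X ≡ toList I → κ ν I (subst (Vec (Fin ν)) e g) ≡ κ ν X g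
  κ-subst refl X I g X≡I = cong (λ U → κ ν U g) (sym (toList-injective X≡I))

  module _ (1<ν : 1 < ν) where

    ρ-zero : ∀ x → isZero ν x ≡ true → ρ ν x ≡ 1ℚ
    ρ-zero x x≡0 = trans (cong (λ b → ((if b then ℕ→ℚ ν else 0ℚ) - 1ℚ) * recip (ℕ→ℚ ν - 1ℚ)) x≡0)
                         (recip-inverseʳ (ℕ→ℚ≢1 1<ν ∘ ν-1≡0⇒ν≡1))
      where
      ν-1≡0⇒ν≡1 : ℕ→ℚ ν - 1ℚ ≡ 0ℚ → ℕ→ℚ ν ≡ 1ℚ
      ν-1≡0⇒ν≡1 e = trans (solve 1 (λ n → n := (n :- con 1ℚ) :+ con 1ℚ) refl (ℕ→ℚ ν)) (cong (ℚ._+ 1ℚ) e)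

    ρ-* : ∀ x (U : Subset k) → ρ ν x * powℚ 1/[1-ν] ∣ U ∣ ≡ powℚ 1/[1-ν] ∣ not (isZero ν x) ∷ U ∣
    ρ-* x U = by-cases (isZero ν x) refl
      where
      by-cases : ∀ b → isZero ν x ≡ b → ρ ν x * powℚ 1/[1-ν] ∣ U ∣ ≡ powℚ 1/[1-ν] ∣ not b ∷ U ∣
      by-cases true  x≡0 = trans (cong (_* _) (ρ-zero x x≡0)) (ℚ.*-identityˡ _)
      by-cases false x≢0 = cong (_* _) (ρ-nonzero x x≢0)

    χ̇-∷-step : ∀ c s x (C S : Subset k) g →
      χ̇ ν (c ∷ []) (s ∷ []) (x ∷ []) * powℚ 1/[1-ν] ∣ (S ∩ ∁ C) ∩ support ν g ∣
        ≡ powℚ 1/[1-ν] ∣ ((s ∷ S) ∩ ∁ (c ∷ C)) ∩ support ν (x ∷ g) ∣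
    χ̇-∷-step true  true  x C S g = ℚ.*-identityˡ _
    χ̇-∷-step true  false x C S g = ℚ.*-identityˡ _
    χ̇-∷-step false false x C S g = ℚ.*-identityˡ _
    χ̇-∷-step false true  x C S g = trans (cong (_* powℚ 1/[1-ν] ∣ U ∣) (χ̇-singleton≡ρ x)) (ρ-* x U)
      where
      U : Subset _
      U = (S ∩ ∁ C) ∩ support ν g

    χ̇≡1/[1-ν]^ : (C S : Subset k) (g : Vec (Fin ν) k) →
                 χ̇ ν C S g ≡ powℚ 1/[1-ν] ∣ (S ∩ ∁ C) ∩ support ν g ∣
    χ̇≡1/[1-ν]^ []      []      []      = refl
    χ̇≡1/[1-ν]^ (c ∷ C) (s ∷ S) (x ∷ g) = begin
      χ̇ ν (c ∷ C) (s ∷ S) (x ∷ g)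
        ≡⟨ χ̇-∷ c s x C S g ⟩
      χ̇ ν (c ∷ []) (s ∷ []) (x ∷ []) * χ̇ ν C S g
        ≡⟨ cong (χ̇ ν (c ∷ []) (s ∷ []) (x ∷ []) *_) (χ̇≡1/[1-ν]^ C S g) ⟩
      χ̇ ν (c ∷ []) (s ∷ []) (x ∷ []) * powℚ 1/[1-ν] ∣ (S ∩ ∁ C) ∩ support ν g ∣
        ≡⟨ χ̇-∷-step c s x C S g ⟩
      powℚ 1/[1-ν] ∣ ((s ∷ S) ∩ ∁ (c ∷ C)) ∩ support ν (x ∷ g) ∣ ∎
      where open ≡-Reasoning

    ⊗₁ρ-κ : (I : Subset t) (v : Vec (Fin ν) (suc t)) {Z : List Bool} →
            toList (support ν v) ≡ Z L.∷ʳ false → ⊗₁ρ ν (κ ν I) v ≡ indicator (Z ≟ₗ toList I)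
    ⊗₁ρ-κ I v {Z} supp-v = begin
      κ ν I (init v) * ρ ν (last v)
        ≡⟨ cong (κ ν I (init v) *_) (ρ-zero (last v) (Bool.not-injective {y = true} (L.∷ʳ-injectiveʳ Sinit Z split))) ⟩
      κ ν I (init v) * 1ℚ
        ≡⟨ ℚ.*-identityʳ _ ⟩
      κ ν I (init v)
        ≡⟨ indicator-⇔ (mk⇔ (λ e → trans (sym Zinit) (cong toList e)) (λ e → toList-injective (trans Zinit e)))
                       (support ν (init v) ≟ₛ I) (Z ≟ₗ toList I) ⟩
      indicator (Z ≟ₗ toList I) ∎
      where
      open ≡-Reasoning
      Sinit : List Bool
      Sinit = toList (support ν (init v))
      split : Sinit L.∷ʳ not (isZero ν (last v)) ≡ Z L.∷ʳ false
      split = begin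
        Sinit L.∷ʳ not (isZero ν (last v))
          ≡⟨ sym (V.toList-∷ʳ _ (support ν (init v))) ⟩
        toList (support ν (init v) ∷ʳ not (isZero ν (last v)))
          ≡⟨ cong toList (sym (V.map-∷ʳ _ (last v) (init v))) ⟩
        toList (support ν (init v ∷ʳ last v))
          ≡⟨ cong (toList ∘ support ν) (sym (proj₂ (proj₂ (initLast v)))) ⟩
        toList (support ν v)
          ≡⟨ supp-v ⟩
        Z L.∷ʳ false ∎
      Zinit : Sinit ≡ Z
      Zinit = L.∷ʳ-injectiveˡ Sinit Z split

    ι*-⊗₁ρ-κ : (S : Subset N) (I : Subset t) (h : Vec (Fin ν) N) {Z : List Bool} → ∣ S ∣ ≡ suc t →
               restrict S (support ν h) ≡ Z L.∷ʳ false → ι* ν S (⊗₁ρ ν (κ ν I)) h ≡ indicator (Z ≟ₗ toList I)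
    ι*-⊗₁ρ-κ {t = t} S I h ∣S∣ ends with length (stdz ν S h) ℕ.≟ suc t
    ... | no  len≢ = contradiction (trans (cong length (stdz≡restrict S h)) (trans (length-restrict S h) ∣S∣)) len≢
    ... | yes len≡ = ⊗₁ρ-κ I v (begin
      toList (support ν v)
        ≡⟨ V.toList-map _ v ⟩
      map (not ∘ isZero ν) (toList v)
        ≡⟨ cong (map (not ∘ isZero ν)) (trans (toList-subst len≡ _) (V.toList∘fromList _)) ⟩
      map (not ∘ isZero ν) (stdz ν S h)
        ≡⟨ cong (map (not ∘ isZero ν)) (stdz≡restrict S h) ⟩
      map (not ∘ isZero ν) (restrict S h)
        ≡⟨ sym (restrict-map _ S h) ⟩
      restrict S (support ν h)
        ≡⟨ ends ⟩
      _ ∎)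
      where
      open ≡-Reasoning
      v : Vec (Fin ν) (suc t)
      v = subst (Vec (Fin ν)) len≡ (V.fromList (stdz ν S h))

    χ̇-c₁-c : (A : Subset N) (g : Vec (Fin ν) (N ∸ 1)) →
             χ̇ ν (c₁ A) (c A) (proj ν (c A) g) ≡ powℚ 1/[1-ν] ∣ support ν g ∩ c₂ A ∣
    χ̇-c₁-c A g = begin
      χ̇ ν (c₁ A) (c A) (proj ν (c A) g)
        ≡⟨ χ̇≡1/[1-ν]^ (c₁ A) (c A) (proj ν (c A) g) ⟩
      powℚ 1/[1-ν] ∣ (c A ∩ ∁ (c₁ A)) ∩ support ν (proj ν (c A) g) ∣
        ≡⟨ cong (λ U → powℚ 1/[1-ν] ∣ (c A ∩ ∁ (c₁ A)) ∩ U ∣) (support-proj (c A) g) ⟩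
      powℚ 1/[1-ν] ∣ (c A ∩ ∁ (c₁ A)) ∩ (c A ∩ support ν g) ∣
        ≡⟨ cong (powℚ 1/[1-ν] ∘ ∣_∣) (∪∩∁∩≡∩ (c₁ A) (c₂ A) (support ν g) (c₁∩c₂≡⊥ A)) ⟩
      powℚ 1/[1-ν] ∣ support ν g ∩ c₂ A ∣ ∎
      where open ≡-Reasoning

    𝐬-κ-κ : ∀ {m n} (A : Subset (suc m + suc n)) (I : Subset m) (J : Subset n) (g : Vec (Fin ν) (m + suc n)) →
      ∣ A ∣ ≡ suc n → 𝐬 ν m n A (κ ν I) (κ ν J) (proj ν (∁ (c A)) g ∷ʳ zeroC ν)
                        ≡ indicator (∁ (c A) ∩ support ν g ≟ₛ #[ suc m , suc n ] I A J)
    𝐬-κ-κ {m} {n} A I J g ∣A∣ = begin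
      ι* ν (∁ A) (⊗₁ρ ν (κ ν I)) h * ι* ν A (⊗₁ρ ν (κ ν J)) h
        ≡⟨ cong₂ _*_ (ι*-⊗₁ρ-κ (∁ A) I h ∣∁A∣ (trans (cong (restrict (∁ A)) supp-h) (proj₂ ends₁)))
                     (ι*-⊗₁ρ-κ A J h ∣A∣ (trans (cong (restrict A) supp-h) (proj₂ ends₂))) ⟩
      indicator (Z₁≟I) * indicator (Z₂≟J)
        ≡⟨ indicator-×-dec Z₁≟I Z₂≟J ⟩
      indicator (Z₁≟I ×-dec Z₂≟J)
        ≡⟨ indicator-⇔ (standardizations⇔# A I J W ∣∁A∣ ∣A∣ (proj₂ ends₁) (proj₂ ends₂))
                       (Z₁≟I ×-dec Z₂≟J) (W ≟ₛ #[ suc m , suc n ] I A J) ⟩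
      indicator (W ≟ₛ #[ suc m , suc n ] I A J) ∎
      where
      open ≡-Reasoning
      T W : Subset (m + suc n)
      T = support ν g
      W = ∁ (c A) ∩ T
      h : Vec (Fin ν) (suc m + suc n)
      h = proj ν (∁ (c A)) g ∷ʳ zeroC ν
      ∣∁A∣ : ∣ ∁ A ∣ ≡ suc m
      ∣∁A∣ = trans (∣∁p∣≡n∸∣p∣ A) (trans (cong (suc m + suc n ∸_) ∣A∣) (ℕP.m+n∸n≡m (suc m) (suc n)))
      supp-h : support ν h ≡ W ∷ʳ false
      supp-h = trans (V.map-∷ʳ _ (zeroC ν) (proj ν (∁ (c A)) g))
                     (cong₂ _∷ʳ_ (support-proj (∁ (c A)) g) (cong not (isZero-zeroC ν)))
      ends₁ : ∃[ Z ] restrict (∁ A) (W ∷ʳ false) ≡ Z L.∷ʳ false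
      ends₁ = restrict-∷ʳ-false (∁ A) W
                (subst (λ C → (∁ C ∩ T) ∩ c₂ A ≡ ⊥) (∪-comm (c₂ A) (c₁ A)) (∁∪∩∩≡⊥ (c₂ A) (c₁ A) T))
                ∣∁A∣
      ends₂ : ∃[ Z ] restrict A (W ∷ʳ false) ≡ Z L.∷ʳ false
      ends₂ = restrict-∷ʳ-false A W (∁∪∩∩≡⊥ (c₁ A) (c₂ A) T) ∣A∣
      Z₁≟I : Dec (proj₁ ends₁ ≡ toList I)
      Z₁≟I = proj₁ ends₁ ≟ₗ toList I
      Z₂≟J : Dec (proj₁ ends₂ ≡ toList J)
      Z₂≟J = proj₁ ends₂ ≟ₗ toList J

    𝐦[]-κ-κ : ∀ {m n} (A : Subset (suc m + suc n)) (I : Subset m) (J : Subset n) (g : Vec (Fin ν) (m + suc n)) →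
      ∣ A ∣ ≡ suc n → 𝐦[_] ν A (κ ν I) (κ ν J) g ≡ dTerm (suc m) (suc n) I J (support ν g) A
    𝐦[]-κ-κ {m} {n} A I J g ∣A∣ =
      trans (cong₂ _*_ (χ̇-c₁-c A g) (𝐬-κ-κ A I J g ∣A∣)) (sym (dTerm≡ (suc m) (suc n) I J (support ν g) A))

    𝐦-κ-κ : ∀ m n I J (g : Vec (Fin ν) (m + n ∸ 1)) →
      𝐦 ν m n (κ ν I) (κ ν J) g ≡ sumℚ (map (dTerm m n I J (support ν g)) (choose (m + n) n))
    𝐦-κ-κ zero n [] J g = begin
      1ℚ * κ ν J g
        ≡⟨ ℚ.*-identityˡ _ ⟩
      κ ν J g
        ≡⟨ κ-subst refl (#[ 0 , n ] [] ⊤ J) J g (toList-#-⊤ n J) ⟩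
      indicator (support ν g ≟ₛ #[ 0 , n ] [] ⊤ J)
        ≡⟨ sym (dTerm-replicate 0 n [] J (support ν g) true) ⟩
      dTerm 0 n [] J (support ν g) ⊤
        ≡⟨ sym (sumℚ-choose-unique n n ⊤ (λ A → sym ∘ ∣p∣≡n⇒p≡⊤) (∣⊤∣≡n n) _) ⟩
      sumℚ (map (dTerm 0 n [] J (support ν g)) (choose n n)) ∎
      where open ≡-Reasoning
    𝐦-κ-κ (suc m) zero I [] g = begin
      κ ν I (subst (Vec (Fin ν)) e g) * 1ℚ
        ≡⟨ ℚ.*-identityʳ _ ⟩
      κ ν I (subst (Vec (Fin ν)) e g)
        ≡⟨ κ-subst e (#[ suc m , 0 ] I ⊥ []) I g (toList-#-⊥ m I) ⟩
      indicator (support ν g ≟ₛ #[ suc m , 0 ] I ⊥ [])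
        ≡⟨ sym (dTerm-replicate (suc m) 0 I [] (support ν g) false) ⟩
      dTerm (suc m) 0 I [] (support ν g) ⊥
        ≡⟨ sym (sumℚ-choose-unique (suc m + 0) 0 ⊥ (λ A → sym ∘ ∣p∣≡0⇒p≡⊥ A) (∣⊥∣≡0 (suc m + 0)) _) ⟩
      sumℚ (map (dTerm (suc m) 0 I [] (support ν g)) (choose (suc m + 0) 0)) ∎
      where
      open ≡-Reasoning
      e : m + 0 ≡ m
      e = ℕP.+-identityʳ m
    𝐦-κ-κ (suc m) (suc n) I J g =
      cong sumℚ (L.map-cong-local (All.map (λ {A} → 𝐦[]-κ-κ A I J g)
                                          (all-filter (λ A → ∣ A ∣ ℕ.≟ suc n) (allSubsets (suc m + suc n)))))

proposition3p15 : (ν : ℕ) {{nz : NonZero ν}} → 1 < ν →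
    (m n : ℕ) (I : Subset (m ∸ 1)) (J : Subset (n ∸ 1)) →
    (g : Vec (Fin ν) (m + n ∸ 1)) →
    𝐦 ν m n (κ ν I) (κ ν J) g
      ≡ sumℚ (map (λ K → d ν m n I J K * κ ν K g) (allSubsets (m + n ∸ 1)))
proposition3p15 ν 1<ν m n I J g = trans (𝐦-κ-κ ν 1<ν m n I J g) (sym (sumℚ-d-κ ν m n I J g))
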